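{- Let $\mathbb{F}$ be a finite field with $|\mathbb{F}|>2$ and let $n\ge 2$. Then $\mathrm{diam}(C_{T_n(\mathbb{F})})=2$.
   Context: For a finite ring $R$ with identity, the unitary Cayley graph $C_R$ is the simple graph with vertex set $R$ in which distinct $x,y\in R$ are adjacent if and only if $x-y$ is a unit of $R$. $T_n(\mathbb{F})$ denotes the ring of all upper triangular $n\times n$ matrices over $\mathbb{F}$. For a connected graph $G$, $\mathrm{diam}(G)=\max\{d_G(u,v): u,v\in V(G)\}$, where $d_G$ is the shortest-path distance. -}

module Defs where

open import Level using (Level; _⊔_)
open import Data.Nat using (ℕ; zero; suc; _<_; _≤_)
open import Data.Fin using (Fin)
import Data.Fin as Fin
open import Data.Product using (Σ; ∃; _×_; _,_; proj₁)
open import Relation.Nullary using (¬_)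
open import Algebra.Bundles using (CommutativeRing)

IsField : ∀ {c ℓ} → CommutativeRing c ℓ → Set (c ⊔ ℓ)
IsField R = ¬ (0# ≈ 1#) × (∀ x → ¬ (x ≈ 0#) → ∃ λ y → x * y ≈ 1#)
  where open CommutativeRing R

module GraphTheory {v e r : Level} (V : Set v) (_≈_ : V → V → Set e)
                   (Adj : V → V → Set r) where

  data Walk : V → V → ℕ → Set (v ⊔ e ⊔ r) where
    here : ∀ {u w} → u ≈ w → Walk u w zero
    step : ∀ {u x w k} → Adj u x → Walk x w k → Walk u w (suc k)

  Dist : V → V → ℕ → Set (v ⊔ e ⊔ r)
  Dist u w d = Walk u w d × (∀ k → k < d → ¬ Walk u w k)

  Diam : ℕ → Set (v ⊔ e ⊔ r)
  Diam d = (∀ u w → ∃ λ m → m ≤ d × Dist u w m)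
         × (∃ λ u → ∃ λ w → Dist u w d)

module UpperTriangular {c ℓ} (R : CommutativeRing c ℓ) where
  open CommutativeRing R
  open import Algebra.Definitions.RawMonoid +-rawMonoid using (sum)

  Mat : ℕ → Set c
  Mat n = Fin n → Fin n → Carrier

  _≈ₘ_ : ∀ {n} → Mat n → Mat n → Set ℓ
  A ≈ₘ B = ∀ i j → A i j ≈ B i j

  _-ₘ_ : ∀ {n} → Mat n → Mat n → Mat n
  (A -ₘ B) i j = A i j - B i j

  _·ₘ_ : ∀ {n} → Mat n → Mat n → Mat n
  (A ·ₘ B) i j = sum (λ k → A i k * B k j)

  Iₘ : ∀ {n} → Mat n
  Iₘ i j with i Fin.≟ j
  ... | Relation.Nullary.yes _ = 1#
  ... | Relation.Nullary.no _ = 0#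

  T : ℕ → Set (c ⊔ ℓ)
  T n = Σ (Mat n) λ A → ∀ i j → j Fin.< i → A i j ≈ 0#

  _≈ᵀ_ : ∀ {n} → T n → T n → Set ℓ
  A ≈ᵀ B = proj₁ A ≈ₘ proj₁ B

  _-ᵀ_ : ∀ {n} → T n → T n → Mat n
  A -ᵀ B = proj₁ A -ₘ proj₁ B

  IsUnitT : ∀ {n} → Mat n → Set (c ⊔ ℓ)
  IsUnitT {n} A = ∃ λ (B : T n) → ((A ·ₘ proj₁ B) ≈ₘ Iₘ) × ((proj₁ B ·ₘ A) ≈ₘ Iₘ)

  Adj : ∀ {n} → T n → T n → Set (c ⊔ ℓ)
  Adj A B = ¬ (A ≈ᵀ B) × IsUnitT (A -ᵀ B)

  DiamCayleyT : ℕ → ℕ → Set (c ⊔ ℓ)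
  DiamCayleyT n d = GraphTheory.Diam (T n) _≈ᵀ_ Adj d

{-# OPTIONS --safe #-}
-- An upper triangular matrix is a unit of T_n(F) exactly when its diagonal entries are
-- nonzero; the inverse is built recursively from the block form [[a, r], [0, M']].
-- Hence distinct A and B are adjacent iff A_kk ≠ B_kk for every k.  If instead
-- A_ii = B_ii for some i, they are joined through the diagonal matrix whose k-th entry
-- differs from both A_kk and B_kk, which exists because |F| ≥ 3.  The zero matrix and
-- the matrix unit at position (1,2) are at distance exactly 2.  Finiteness of F is used
-- only to decide equality in F and to find such third elements.
module Submission where

open import Defs
open import Data.Nat using (ℕ; _<_; _≤_)
open import Data.Fin using (Fin)
open import Algebra.Bundles using (CommutativeRing)
open import Function.Bundles using (Inverse)
open import Relation.Binary.PropositionalEquality using (setoid)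

open import Data.Nat using (zero; suc; z≤n; s≤s)
open import Data.Fin using (zero; suc)
import Data.Fin as Fin
import Data.Fin.Properties as Finₚ
open import Data.Product using (∃; _×_; _,_; proj₁; proj₂)
open import Data.Empty using (⊥-elim)
open import Function using (_∘_)
open import Function.Properties.Inverse using (Inverse⇒Injection)
import Function.Construct.Symmetry as Symmetry
open import Relation.Nullary using (¬_; Dec; yes; no)
open import Relation.Nullary.Decidable using (via-injection)
open import Relation.Binary.Bundles using (Setoid)
open import Relation.Binary.Definitions using (Decidable; tri<; tri≈; tri>)
open import Relation.Binary.PropositionalEquality as ≡ using (_≡_; _≢_)

module Distances {v e r} (V : Set v) (_≈_ : V → V → Set e) (Adj : V → V → Set r)
                 (≈-refl : ∀ {u} → u ≈ u) where
  open GraphTheory V _≈_ Adj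

  dist-0 : ∀ {u w} → u ≈ w → Dist u w 0
  dist-0 u≈w = here u≈w , λ _ ()

  dist-1 : ∀ {u w} → ¬ u ≈ w → Adj u w → Dist u w 1
  dist-1 u≉w u~w = step u~w (here ≈-refl) , shorter
    where
    shorter : ∀ k → k < 1 → ¬ Walk _ _ k
    shorter zero _ (here u≈w) = u≉w u≈w
    shorter (suc _) (s≤s ())

  dist-2 : ∀ {u x w} → ¬ u ≈ w → (∀ y → Adj u y → ¬ y ≈ w) →
           Adj u x → Adj x w → Dist u w 2
  dist-2 {u} {x} {w} u≉w no-edge u~x x~w = step u~x (step x~w (here ≈-refl)) , shorter
    where
    shorter : ∀ k → k < 2 → ¬ Walk u w k
    shorter zero _ (here u≈w) = u≉w u≈w
    shorter (suc zero) _ (step {x = y} u~y (here y≈w)) = no-edge y u~y y≈w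
    shorter (suc (suc _)) (s≤s (s≤s ()))

module UpperTriangularMatrices {c ℓ} (F : CommutativeRing c ℓ) where
  open CommutativeRing F hiding (zero)
  open UpperTriangular F
  open import Algebra.Properties.Ring ring using (-‿distribˡ-*; -‿distribʳ-*)
  open import Algebra.Properties.Semiring.Sum semiring
    using (sum; sum-cong-≋; sum-replicate-zero; ∑-comm; *-distribˡ-sum; *-distribʳ-sum)
  open import Relation.Binary.Reasoning.Setoid (CommutativeRing.setoid F)

  IsUpper : ∀ {n} → Mat n → Set ℓ
  IsUpper M = ∀ i j → j Fin.< i → M i j ≈ 0#

  lower : ∀ {n} → Mat (suc n) → Mat n
  lower M i j = M (suc i) (suc j)

  lower-upper : ∀ {n} {M : Mat (suc n)} → IsUpper M → IsUpper (lower M)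
  lower-upper M-upper i j j<i = M-upper (suc i) (suc j) (s≤s j<i)

  sum-zero : ∀ {n} {f : Fin n → Carrier} → (∀ k → f k ≈ 0#) → sum f ≈ 0#
  sum-zero {n} f≈0 = trans (sum-cong-≋ f≈0) (sum-replicate-zero n)

  Iₘ-diagonal : ∀ {n} (i : Fin n) → Iₘ i i ≈ 1#
  Iₘ-diagonal i with i Fin.≟ i
  ... | yes _ = refl
  ... | no i≢i = ⊥-elim (i≢i ≡.refl)

  Iₘ-off-diagonal : ∀ {n} {i j : Fin n} → i ≢ j → Iₘ i j ≈ 0#
  Iₘ-off-diagonal {i = i} {j} i≢j with i Fin.≟ j
  ... | yes i≡j = ⊥-elim (i≢j i≡j)
  ... | no _ = refl

  Iₘ-suc : ∀ {n} (i j : Fin n) → Iₘ (suc i) (suc j) ≈ Iₘ i j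
  -- A `with` on i ≟ j would also abstract the test hidden inside Iₘ i j.
  Iₘ-suc i j = by-cases (i Fin.≟ j)
    where
    by-cases : Dec (i ≡ j) → Iₘ (suc i) (suc j) ≈ Iₘ i j
    by-cases (yes ≡.refl) = trans (Iₘ-diagonal (suc i)) (sym (Iₘ-diagonal i))
    by-cases (no i≢j) =
      trans (Iₘ-off-diagonal (i≢j ∘ Finₚ.suc-injective)) (sym (Iₘ-off-diagonal i≢j))

  *-Iₘ-diagonal : ∀ {n} x (i : Fin n) → x * Iₘ i i ≈ x
  *-Iₘ-diagonal x i = trans (*-congˡ (Iₘ-diagonal i)) (*-identityʳ x)

  *-Iₘ-off-diagonal : ∀ {n} x {i j : Fin n} → i ≢ j → x * Iₘ i j ≈ 0#
  *-Iₘ-off-diagonal x i≢j = trans (*-congˡ (Iₘ-off-diagonal i≢j)) (zeroʳ x)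

  sum-*-Iₘ : ∀ {n} (r : Fin n → Carrier) (j : Fin n) → sum (λ l → r l * Iₘ l j) ≈ r j
  sum-*-Iₘ r zero =
    trans (+-cong (*-identityʳ (r zero)) (sum-zero λ l → zeroʳ (r (suc l))))
          (+-identityʳ (r zero))
  sum-*-Iₘ r (suc j) =
    trans (+-cong (zeroʳ (r zero))
                  (trans (sum-cong-≋ λ l → *-congˡ (Iₘ-suc l j)) (sum-*-Iₘ (r ∘ suc) j)))
          (+-identityˡ (r (suc j)))

  sum-*-·ₘ-assoc : ∀ {n} (r : Fin n → Carrier) (B M : Mat n) (j : Fin n) →
    sum (λ k → sum (λ l → r l * B l k) * M k j) ≈ sum (λ l → r l * (B ·ₘ M) l j)
  sum-*-·ₘ-assoc r B M j = begin
    sum (λ k → sum (λ l → r l * B l k) * M k j)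
      ≈⟨ sum-cong-≋ (λ k → *-distribʳ-sum (M k j) (λ l → r l * B l k)) ⟩
    sum (λ k → sum (λ l → (r l * B l k) * M k j))
      ≈⟨ ∑-comm (λ k l → (r l * B l k) * M k j) ⟩
    sum (λ l → sum (λ k → (r l * B l k) * M k j))
      ≈⟨ sum-cong-≋ (λ l → sum-cong-≋ λ k → *-assoc (r l) (B l k) (M k j)) ⟩
    sum (λ l → sum (λ k → r l * (B l k * M k j)))
      ≈⟨ sum-cong-≋ (λ l → *-distribˡ-sum (r l) (λ k → B l k * M k j)) ⟨
    sum (λ l → r l * (B ·ₘ M) l j)
      ∎

  module BlockInverse {n} (M : Mat (suc n)) (M-upper : IsUpper M)
                      (a⁻¹ : Carrier) (aa⁻¹≈1 : M zero zero * a⁻¹ ≈ 1#)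
                      (B' : Mat n) (B'-upper : IsUpper B')
                      (M'B'≈I : (lower M ·ₘ B') ≈ₘ Iₘ) (B'M'≈I : (B' ·ₘ lower M) ≈ₘ Iₘ) where
    private
      a : Carrier
      a = M zero zero

      r : Fin n → Carrier
      r j = M zero (suc j)

      M' : Mat n
      M' = lower M

      r·B' : Fin n → Carrier
      r·B' j = sum (λ k → r k * B' k j)

      column≈0-* : ∀ i x → M (suc i) zero * x ≈ 0#
      column≈0-* i x = trans (*-congʳ (M-upper (suc i) zero (s≤s z≤n))) (zeroˡ x)

      *-column≈0 : ∀ i x → x * M (suc i) zero ≈ 0#
      *-column≈0 i x = trans (*-comm x _) (column≈0-* i x)

    B : Mat (suc n)
    B zero    zero    = a⁻¹
    B zero    (suc j) = - (a⁻¹ * r·B' j)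
    B (suc i) zero    = 0#
    B (suc i) (suc j) = B' i j

    B-upper : IsUpper B
    B-upper (suc i) zero    _         = refl
    B-upper (suc i) (suc j) (s≤s j<i) = B'-upper i j j<i

    M·B≈I : (M ·ₘ B) ≈ₘ Iₘ
    M·B≈I zero zero =
      trans (+-cong aa⁻¹≈1 (sum-zero λ k → zeroʳ (r k))) (+-identityʳ 1#)
    M·B≈I zero (suc j) = begin
      a * - (a⁻¹ * r·B' j) + r·B' j   ≈⟨ +-congʳ (-‿distribʳ-* a (a⁻¹ * r·B' j)) ⟨
      - (a * (a⁻¹ * r·B' j)) + r·B' j ≈⟨ +-congʳ (-‿cong (*-assoc a a⁻¹ (r·B' j))) ⟨
      - ((a * a⁻¹) * r·B' j) + r·B' j ≈⟨ +-congʳ (-‿cong (*-congʳ aa⁻¹≈1)) ⟩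
      - (1# * r·B' j) + r·B' j        ≈⟨ +-congʳ (-‿cong (*-identityˡ (r·B' j))) ⟩
      - r·B' j + r·B' j               ≈⟨ -‿inverseˡ (r·B' j) ⟩
      0#                              ∎
    M·B≈I (suc i) zero =
      trans (+-cong (column≈0-* i a⁻¹) (sum-zero λ k → zeroʳ (M' i k))) (+-identityʳ 0#)
    M·B≈I (suc i) (suc j) =
      trans (+-cong (column≈0-* i (B zero (suc j))) (M'B'≈I i j))
            (trans (+-identityˡ (Iₘ i j)) (sym (Iₘ-suc i j)))

    B·M≈I : (B ·ₘ M) ≈ₘ Iₘ
    B·M≈I zero zero =
      trans (+-cong (trans (*-comm a⁻¹ a) aa⁻¹≈1) (sum-zero λ k → *-column≈0 k (B zero (suc k))))
            (+-identityʳ 1#)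
    B·M≈I zero (suc j) = begin
      a⁻¹ * r j + sum (λ k → - (a⁻¹ * r·B' k) * M' k j)
        ≈⟨ +-congˡ (sum-cong-≋ λ k → trans (sym (*-assoc (- a⁻¹) (r·B' k) (M' k j)))
                                            (*-congʳ (sym (-‿distribˡ-* a⁻¹ (r·B' k))))) ⟨
      a⁻¹ * r j + sum (λ k → - a⁻¹ * (r·B' k * M' k j))
        ≈⟨ +-congˡ (*-distribˡ-sum (- a⁻¹) (λ k → r·B' k * M' k j)) ⟨
      a⁻¹ * r j + - a⁻¹ * sum (λ k → r·B' k * M' k j)
        ≈⟨ +-congˡ (*-congˡ r·B'·M'≈r) ⟩
      a⁻¹ * r j + - a⁻¹ * r j ≈⟨ distribʳ (r j) a⁻¹ (- a⁻¹) ⟨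
      (a⁻¹ - a⁻¹) * r j       ≈⟨ *-congʳ (-‿inverseʳ a⁻¹) ⟩
      0# * r j                ≈⟨ zeroˡ (r j) ⟩
      0#                      ∎
      where
      r·B'·M'≈r : sum (λ k → r·B' k * M' k j) ≈ r j
      r·B'·M'≈r = begin
        sum (λ k → r·B' k * M' k j)     ≈⟨ sum-*-·ₘ-assoc r B' M' j ⟩
        sum (λ l → r l * (B' ·ₘ M') l j) ≈⟨ sum-cong-≋ (λ l → *-congˡ (B'M'≈I l j)) ⟩
        sum (λ l → r l * Iₘ l j)         ≈⟨ sum-*-Iₘ r j ⟩
        r j                              ∎
    B·M≈I (suc i) zero =
      trans (+-cong (zeroˡ a) (sum-zero λ k → *-column≈0 k (B' i k))) (+-identityʳ 0#)
    B·M≈I (suc i) (suc j) =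
      trans (+-cong (zeroˡ (r j)) (B'M'≈I i j)) (trans (+-identityˡ (Iₘ i j)) (sym (Iₘ-suc i j)))

  upper⇒unit : IsField F → ∀ {n} (M : Mat n) → IsUpper M → (∀ i → ¬ M i i ≈ 0#) → IsUnitT M
  upper⇒unit isField {zero} M _ _ = ((λ ()) , λ ()) , (λ ()) , λ ()
  upper⇒unit isField {suc n} M M-upper M-diagonal
    with proj₂ isField (M zero zero) (M-diagonal zero)
       | upper⇒unit isField (lower M) (lower-upper M-upper) (M-diagonal ∘ suc)
  ... | a⁻¹ , aa⁻¹≈1 | (B' , B'-upper) , M'B'≈I , B'M'≈I = (B , B-upper) , M·B≈I , B·M≈I
    where open BlockInverse M M-upper a⁻¹ aa⁻¹≈1 B' B'-upper M'B'≈I B'M'≈I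

  zero-diagonal⇒¬unit : ¬ 0# ≈ 1# → ∀ {n} {D : Mat n} → IsUpper D →
                        ∀ i → D i i ≈ 0# → ¬ IsUnitT D
  zero-diagonal⇒¬unit 0≉1 {D = D} D-upper i Dii≈0 ((B , B-upper) , D·B≈I , _) = 0≉1 (begin
    0#           ≈⟨ sum-zero term≈0 ⟨
    (D ·ₘ B) i i ≈⟨ D·B≈I i i ⟩
    Iₘ i i       ≈⟨ Iₘ-diagonal i ⟩
    1#           ∎)
    where
    term≈0 : ∀ k → D i k * B k i ≈ 0#
    term≈0 k with Finₚ.<-cmp k i
    ... | tri< k<i _ _    = trans (*-congʳ (D-upper i k k<i)) (zeroˡ (B k i))
    ... | tri≈ _ ≡.refl _ = trans (*-congʳ Dii≈0) (zeroˡ (B k i))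
    ... | tri> _ _ i<k    = trans (*-congˡ (B-upper k i i<k)) (zeroʳ (D i k))

module UnitaryCayleyGraph {c ℓ} (F : CommutativeRing c ℓ) (isField : IsField F)
  (_≟_ : Decidable (CommutativeRing._≈_ F))
  (avoid : ∀ x y → ∃ λ z → ¬ CommutativeRing._≈_ F z x × ¬ CommutativeRing._≈_ F z y) where
  open CommutativeRing F hiding (zero)
  open UpperTriangular F
  open UpperTriangularMatrices F
  open import Algebra.Properties.Group +-group using (x∙y⁻¹≈ε⇒x≈y; x≈y⇒x∙y⁻¹≈ε)

  _≟ᵀ_ : ∀ {n} → Decidable (_≈ᵀ_ {n})
  A ≟ᵀ B = Finₚ.all? λ i → Finₚ.all? λ j → proj₁ A i j ≟ proj₁ B i j

  -ᵀ-upper : ∀ {n} (A B : T n) → IsUpper (A -ᵀ B)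
  -ᵀ-upper A B i j j<i = trans (+-cong (proj₂ A i j j<i) (-‿cong (proj₂ B i j j<i))) (-‿inverseʳ 0#)

  Apart : ∀ {n} → T n → T n → Set ℓ
  Apart A B = ∀ k → ¬ proj₁ A k k ≈ proj₁ B k k

  apart⇒unit : ∀ {n} (A B : T n) → Apart A B → IsUnitT (A -ᵀ B)
  apart⇒unit A B A#B =
    upper⇒unit isField (A -ᵀ B) (-ᵀ-upper A B) (λ k Akk-Bkk≈0 → A#B k (x∙y⁻¹≈ε⇒x≈y _ _ Akk-Bkk≈0))

  equal-diagonal⇒¬unit : ∀ {n} (A B : T n) k → proj₁ A k k ≈ proj₁ B k k → ¬ IsUnitT (A -ᵀ B)
  equal-diagonal⇒¬unit A B k Akk≈Bkk =
    zero-diagonal⇒¬unit (proj₁ isField) (-ᵀ-upper A B) k (x≈y⇒x∙y⁻¹≈ε Akk≈Bkk)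

  apart⇒adjacent : ∀ {n} (A B : T n) → Fin n → Apart A B → Adj A B
  apart⇒adjacent A B k A#B = (λ A≈B → A#B k (A≈B k k)) , apart⇒unit A B A#B

  diagonalᵀ : ∀ {n} → (Fin n → Carrier) → T n
  diagonalᵀ x = (λ k l → x k * Iₘ k l)
              , λ k l l<k → *-Iₘ-off-diagonal (x k) λ k≡l → Finₚ.<-irrefl (≡.sym k≡l) l<k

  midpoint : ∀ {n} → T n → T n → T n
  midpoint A B = diagonalᵀ λ k → proj₁ (avoid (proj₁ A k k) (proj₁ B k k))

  apart-midpointˡ : ∀ {n} (A B : T n) → Apart A (midpoint A B)
  apart-midpointˡ A B k Akk≈z with avoid (proj₁ A k k) (proj₁ B k k)
  ... | z , z≉Akk , _ = z≉Akk (sym (trans Akk≈z (*-Iₘ-diagonal z k)))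

  apart-midpointʳ : ∀ {n} (A B : T n) → Apart (midpoint A B) B
  apart-midpointʳ A B k z≈Bkk with avoid (proj₁ A k k) (proj₁ B k k)
  ... | z , _ , z≉Bkk = z≉Bkk (trans (sym (*-Iₘ-diagonal z k)) z≈Bkk)

  module _ {n : ℕ} where
    open GraphTheory (T n) _≈ᵀ_ Adj
    open Distances (T n) _≈ᵀ_ Adj (λ _ _ → refl)

    distance-2 : ∀ {A B : T n} → ¬ A ≈ᵀ B → ∀ i → proj₁ A i i ≈ proj₁ B i i → Dist A B 2
    distance-2 {A} {B} A≉B i Aii≈Bii =
      dist-2 {x = X} A≉B no-edge (apart⇒adjacent A X i (apart-midpointˡ A B))
                                 (apart⇒adjacent X B i (apart-midpointʳ A B))
      where
      X : T n
      X = midpoint A B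

      no-edge : ∀ Y → Adj A Y → ¬ Y ≈ᵀ B
      no-edge Y (_ , A-Y-unit) Y≈B =
        equal-diagonal⇒¬unit A Y i (trans Aii≈Bii (sym (Y≈B i i))) A-Y-unit

    distance≤2 : ∀ A B → ∃ λ m → m ≤ 2 × Dist A B m
    distance≤2 A B with A ≟ᵀ B
    ... | yes A≈B = 0 , z≤n , dist-0 A≈B
    ... | no A≉B with Finₚ.any? (λ i → proj₁ A i i ≟ proj₁ B i i)
    ...   | yes (i , Aii≈Bii) = 2 , s≤s (s≤s z≤n) , distance-2 A≉B i Aii≈Bii
    ...   | no ¬Aii≈Bii =
      1 , s≤s z≤n , dist-1 A≉B (A≉B , apart⇒unit A B λ k e → ¬Aii≈Bii (k , e))

  0ᵀ : ∀ {n} → T n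
  0ᵀ = (λ _ _ → 0#) , λ _ _ _ → refl

  E₀₁ : ∀ {n} → T (suc (suc n))
  E₀₁ = E , E-upper
    where
    E : Mat (suc (suc _))
    E zero (suc zero) = 1#
    E _    _          = 0#

    E-upper : IsUpper E
    E-upper (suc _) _ _ = refl

  diameter : ∀ {n} → 2 ≤ n → DiamCayleyT n 2
  diameter (s≤s (s≤s _)) =
    distance≤2 , 0ᵀ , E₀₁ , distance-2 (λ 0≈E → proj₁ isField (0≈E zero (suc zero))) zero refl

Fin-avoid : ∀ {q} → 2 < q → (a b : Fin q) → ∃ λ k → k ≢ a × k ≢ b
Fin-avoid (s≤s (s≤s (s≤s _))) zero          zero          = suc zero , (λ ()) , (λ ())
Fin-avoid (s≤s (s≤s (s≤s _))) zero          (suc zero)    = suc (suc zero) , (λ ()) , (λ ())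
Fin-avoid (s≤s (s≤s (s≤s _))) zero          (suc (suc _)) = suc zero , (λ ()) , (λ ())
Fin-avoid (s≤s (s≤s (s≤s _))) (suc zero)    zero          = suc (suc zero) , (λ ()) , (λ ())
Fin-avoid (s≤s (s≤s (s≤s _))) (suc (suc _)) zero          = suc zero , (λ ()) , (λ ())
Fin-avoid (s≤s (s≤s (s≤s _))) (suc _)       (suc _)       = zero , (λ ()) , (λ ())

module _ {a ℓ q} {S : Setoid a ℓ} (enumeration : Inverse (setoid (Fin q)) S) where
  open Setoid S
  open Inverse enumeration

  avoid-via-enumeration : 2 < q → ∀ x y → ∃ λ z → ¬ z ≈ x × ¬ z ≈ y
  avoid-via-enumeration 2<q x y with Fin-avoid 2<q (from x) (from y)
  ... | k , k≢x , k≢y = to k , k≢x ∘ from-to , k≢y ∘ from-to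
    where
    from-to : ∀ {z} → to k ≈ z → k ≡ from z
    from-to to-k≈z = ≡.trans (≡.sym (strictlyInverseʳ k)) (from-cong to-k≈z)

  ≟-via-enumeration : Decidable _≈_
  ≟-via-enumeration = via-injection (Inverse⇒Injection (Symmetry.inverse enumeration)) Finₚ._≟_

corollary1 : ∀ {c ℓ} (F : CommutativeRing c ℓ) → IsField F
    → (q : ℕ) → Inverse (setoid (Fin q)) (CommutativeRing.setoid F) → 2 < q
    → (n : ℕ) → 2 ≤ n
    → UpperTriangular.DiamCayleyT F n 2
corollary1 F isField q enumeration 2<q n 2≤n =
  UnitaryCayleyGraph.diameter F isField (≟-via-enumeration enumeration)
    (avoid-via-enumeration enumeration 2<q) 2≤n
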